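{- Let $\mathcal{M}$ be a countably infinite graph which is $\geq$$k$-homogeneous for some $k\geq1$, is not $1$-homogeneous, and contains an induced subgraph isomorphic to $K_\infty$. Suppose $\mathcal{M}$ has exactly two $1$-orbits, an infinite one $p$ and a finite one $q$. If $a\in p$ and $b\in q$ then $a$ is not adjacent to $b$.
   Context: A graph is $k$-homogeneous if every embedding (injective map preserving adjacency and non-adjacency) of an induced subgraph with $k$ vertices into the graph extends to an automorphism; $\geq$$k$-homogeneous means $t$-homogeneous for all $t\geq k$. A $1$-orbit is an orbit of the automorphism group on vertices. $K_\infty$ is the countably infinite complete graph. -}

module Defs where

open import Level using (Level; _⊔_; suc)
open import Data.Nat using (ℕ; _≤_; _≥_)
open import Data.Fin using (Fin)
open import Data.Product using (Σ; _×_; ∃; ∃-syntax)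
open import Data.List using (List)
open import Data.Sum using (_⊎_)
open import Data.List.Membership.Propositional using (_∈_)
open import Relation.Nullary using (¬_)
open import Relation.Binary.PropositionalEquality using (_≡_; _≢_)
open import Function using (_∘_; id; _⇔_)
open import Function.Definitions using (Injective)

record Graph : Set₁ where
  field
    E     : ℕ → ℕ → Set
    sym   : ∀ {x y} → E x y → E y x
    irrfl : ∀ {x} → ¬ E x x
open Graph public

record Aut (G : Graph) : Set where
  field
    σ        : ℕ → ℕ
    σ⁻¹      : ℕ → ℕ
    inv₁     : ∀ x → σ (σ⁻¹ x) ≡ x
    inv₂     : ∀ x → σ⁻¹ (σ x) ≡ x
    preserve : ∀ x y → E G x y ⇔ E G (σ x) (σ y)
open Aut public

-- t-homogeneous: every embedding of an induced t-vertex subgraph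
-- (induced on the injective enumeration g of t vertices) into G,
-- i.e. an injective map e with  E (g i) (g j) ⇔ E (e i) (e j),
-- extends to an automorphism.
Homogeneous : ℕ → Graph → Set
Homogeneous t G =
  (g e : Fin t → ℕ) → Injective _≡_ _≡_ g → Injective _≡_ _≡_ e →
  (∀ i j → E G (g i) (g j) ⇔ E G (e i) (e j)) →
  Σ (Aut G) λ α → ∀ i → σ α (g i) ≡ e i

HomogeneousFrom : ℕ → Graph → Set
HomogeneousFrom k G = ∀ t → t ≥ k → Homogeneous t G

ContainsK∞ : Graph → Set
ContainsK∞ G = Σ (ℕ → ℕ) λ f → Injective _≡_ _≡_ f × (∀ i j → i ≢ j → E G (f i) (f j))

SameOrbit : (G : Graph) → ℕ → ℕ → Set
SameOrbit G x y = Σ (Aut G) λ α → σ α x ≡ y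

OrbitFinite : Graph → ℕ → Set
OrbitFinite G u = Σ (List ℕ) λ xs → ∀ x → SameOrbit G u x → x ∈ xs

OrbitInfinite : Graph → ℕ → Set
OrbitInfinite G u = ¬ OrbitFinite G u

ExactlyTwoOrbits : Graph → ℕ → ℕ → Set
ExactlyTwoOrbits G u v =
  ¬ SameOrbit G u v × (∀ x → SameOrbit G u x ⊎ SameOrbit G v x)

-- Suppose a ∈ p is adjacent to b ∈ q. Moving this edge by automorphisms, every vertex of p
-- has a neighbour in q. Colour each vertex of the infinite clique by itself if it lies in the
-- finite orbit q, and otherwise by one of its neighbours in q: finitely many colours, so k + 1
-- clique vertices w₀, …, w_k get the same colour, which by injectivity is a common neighbour
-- y ∈ q. Then y, w₂, …, w_k and w₁, …, w_k are both k-cliques, and k-homogeneity yields an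
-- automorphism taking y ∈ q to w₁ ∉ q.
module Submission where

open import Data.Empty using (⊥; ⊥-elim)
open import Data.Fin using (Fin; zero; suc; inject≤)
open import Data.Fin.Properties using (inject≤-injective; suc-injective)
open import Data.List using (List; []; _∷_; length; lookup; filter; map; _++_; upTo)
open import Data.List.Properties using (length-upTo)
open import Data.List.Relation.Unary.All as All using (All; _∷_)
open import Data.List.Relation.Unary.All.Properties using (all-filter; filter⁺)
open import Data.List.Relation.Unary.Any using (here; there)
open import Data.List.Relation.Unary.Unique.Propositional using (Unique; _∷_)
open import Data.List.Relation.Unary.Unique.Propositional.Properties using (upTo⁺)
  renaming (filter⁺ to Unique-filter⁺)
open import Data.List.Membership.Propositional using (_∈_; _∉_)
open import Data.List.Membership.Propositional.Properties using (∈-lookup; ∈-map⁺; ∈-++⁺ˡ; ∈-++⁺ʳ)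
open import Data.Nat using (ℕ; zero; suc; _+_; _*_; _<_; _≥_; _<?_; _≟_)
open import Data.Nat.Properties using (+-suc; +-cancelˡ-<; +-monoˡ-≤; ≮⇒≥; <⇒≤; ≤-refl; module ≤-Reasoning)
open import Data.List.Membership.DecPropositional _≟_ using (_∈?_)
open import Data.Product using (Σ; ∃-syntax; _×_; _,_; proj₁; proj₂)
open import Data.Sum using (_⊎_; inj₁; inj₂)
open import Data.Sum.Properties using (≡-dec)
import Data.Vec.Functional as Vector
open import Function using (_∘_; _⇔_)
open import Function.Bundles using (Equivalence; mk⇔)
open import Function.Definitions using (Injective)
open import Relation.Binary.Definitions using (DecidableEquality)
open import Relation.Binary.PropositionalEquality
open import Relation.Nullary using (¬_; yes; no; contradiction)
open import Relation.Unary using (Pred; Decidable)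
open import Relation.Unary.Properties using (∁?)

open import Defs hiding (sym)

Unique⇒lookup-injective : ∀ {a} {A : Set a} {xs : List A} → Unique xs → Injective _≡_ _≡_ (lookup xs)
Unique⇒lookup-injective (_ ∷ _)    {zero}  {zero}  _  = refl
Unique⇒lookup-injective (x∉xs ∷ _) {zero}  {suc j} eq = contradiction eq (All.lookup x∉xs (∈-lookup j))
Unique⇒lookup-injective (x∉xs ∷ _) {suc i} {zero}  eq = contradiction (sym eq) (All.lookup x∉xs (∈-lookup i))
Unique⇒lookup-injective (_ ∷ uniq) {suc i} {suc j} eq = cong suc (Unique⇒lookup-injective uniq eq)

length-filter+length-filter-∁ : ∀ {a p} {A : Set a} {P : Pred A p} (P? : Decidable P) xs →
  length (filter P? xs) + length (filter (∁? P?) xs) ≡ length xs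
length-filter+length-filter-∁ P? [] = refl
length-filter+length-filter-∁ P? (x ∷ xs) with P? x
... | yes _ = cong suc (length-filter+length-filter-∁ P? xs)
... | no _  = trans (+-suc _ _) (cong suc (length-filter+length-filter-∁ P? xs))

module _ {a i} {A : Set a} {I : Set i} (_≟ᴬ_ : DecidableEquality A) (c : I → A) where

  coloured? : ∀ d → Decidable (λ i → c i ≡ d)
  coloured? d i = c i ≟ᴬ d

  monochromatic-sublist : ∀ K (cs : List A) (is : List I) → Unique is →
    All (λ i → c i ∈ cs) is → length cs * K < length is →
    ∃[ j ] ∃[ js ] Unique js × All (λ i → c i ≡ j) js × K < length js
  monochromatic-sublist K [] (_ ∷ _) _ (() ∷ _) _
  monochromatic-sublist K (d ∷ ds) is uniq cover len with K <? length (filter (coloured? d) is)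
  ... | yes K<ys = d , _ , Unique-filter⁺ _ uniq , all-filter _ is , K<ys
  ... | no K≮ys  = monochromatic-sublist K ds zs (Unique-filter⁺ _ uniq) cover′ len′
    where
    ys zs : List I
    ys = filter (coloured? d) is
    zs = filter (∁? (coloured? d)) is

    cover′ : All (λ i → c i ∈ ds) zs
    cover′ = All.zipWith drop-d (filter⁺ _ cover , all-filter _ is)
      where
      drop-d : ∀ {i} → c i ∈ d ∷ ds × c i ≢ d → c i ∈ ds
      drop-d (here eq , ne) = contradiction eq ne
      drop-d (there m , _)  = m

    len′ : length ds * K < length zs
    len′ = +-cancelˡ-< K _ _ (begin-strict
      K + length ds * K          <⟨ len ⟩
      length is                  ≡⟨ sym (length-filter+length-filter-∁ (coloured? d) is) ⟩
      length ys + length zs      ≤⟨ +-monoˡ-≤ (length zs) (≮⇒≥ K≮ys) ⟩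
      K + length zs              ∎)
      where open ≤-Reasoning

module _ {a} {A : Set a} (_≟ᴬ_ : DecidableEquality A) (c : ℕ → A) where

  monochromatic-family : (cs : List A) → (∀ i → c i ∈ cs) → ∀ K →
    ∃[ j ] Σ (Fin K → ℕ) λ s → Injective _≡_ _≡_ s × (∀ x → c (s x) ≡ j)
  monochromatic-family cs cover K
    with j , js , uniq , mono , K<js ← monochromatic-sublist _≟ᴬ_ c K cs (upTo (suc (length cs * K)))
           (upTo⁺ _) (All.tabulate λ {i} _ → cover i) (subst (length cs * K <_) (sym (length-upTo _)) ≤-refl)
    = j , s , s-injective , λ x → All.lookup mono (∈-lookup _)
    where
    s : Fin K → ℕ
    s x = lookup js (inject≤ x (<⇒≤ K<js))
    s-injective : Injective _≡_ _≡_ s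
    s-injective = inject≤-injective _ _ _ _ ∘ Unique⇒lookup-injective uniq

module _ (G : Graph) where
  open Equivalence

  Aut-inverse : Aut G → Aut G
  Aut-inverse α = record
    { σ = σ⁻¹ α ; σ⁻¹ = σ α ; inv₁ = inv₂ α ; inv₂ = inv₁ α
    ; preserve = λ x y → mk⇔
        (λ h → from (preserve α (σ⁻¹ α x) (σ⁻¹ α y)) (subst₂ (E G) (sym (inv₁ α x)) (sym (inv₁ α y)) h))
        (λ h → subst₂ (E G) (inv₁ α x) (inv₁ α y) (to (preserve α (σ⁻¹ α x) (σ⁻¹ α y)) h)) }

  Aut-compose : Aut G → Aut G → Aut G
  Aut-compose β α = record
    { σ = σ β ∘ σ α ; σ⁻¹ = σ⁻¹ α ∘ σ⁻¹ β
    ; inv₁ = λ x → trans (cong (σ β) (inv₁ α _)) (inv₁ β x)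
    ; inv₂ = λ x → trans (cong (σ⁻¹ α) (inv₂ β _)) (inv₂ α x)
    ; preserve = λ x y → mk⇔
        (to (preserve β _ _) ∘ to (preserve α x y))
        (from (preserve α x y) ∘ from (preserve β _ _)) }

  orbit-sym : ∀ {x y} → SameOrbit G x y → SameOrbit G y x
  orbit-sym {x} (α , αx≡y) = Aut-inverse α , trans (cong (σ⁻¹ α) (sym αx≡y)) (inv₂ α x)

  orbit-trans : ∀ {x y z} → SameOrbit G x y → SameOrbit G y z → SameOrbit G x z
  orbit-trans (α , αx≡y) (β , βy≡z) = Aut-compose β α , trans (cong (σ β) αx≡y) βy≡z

  edge-transport : ∀ {a b w} → E G a b → SameOrbit G a w → ∃[ b′ ] SameOrbit G b b′ × E G w b′
  edge-transport {a} {b} ab (α , αa≡w) =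
    σ α b , (α , refl) , subst (λ z → E G z (σ α b)) αa≡w (to (preserve α a b) ab)

  IsClique : ∀ {I : Set} → (I → ℕ) → Set
  IsClique w = ∀ i j → i ≢ j → E G (w i) (w j)

  ∘-isClique : ∀ {I J : Set} {w : I → ℕ} {s : J → I} → IsClique w → Injective _≡_ _≡_ s → IsClique (w ∘ s)
  ∘-isClique w-clique s-injective i j i≢j = w-clique _ _ (i≢j ∘ s-injective)

  cliques-same-adjacency : ∀ {t} {w w′ : Fin t → ℕ} → IsClique w → IsClique w′ →
    ∀ i j → E G (w i) (w j) ⇔ E G (w′ i) (w′ j)
  cliques-same-adjacency w-clique w′-clique i j with i Data.Fin.≟ j
  ... | yes refl = mk⇔ (⊥-elim ∘ irrfl G) (⊥-elim ∘ irrfl G)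
  ... | no i≢j  = mk⇔ (λ _ → w′-clique i j i≢j) (λ _ → w-clique i j i≢j)

  common-neighbour-orbit : ∀ {t x} → Homogeneous (suc t) G → (w : Fin (suc t) → ℕ) →
    Injective _≡_ _≡_ w → IsClique w → (∀ i → E G x (w i)) → SameOrbit G x (w zero)
  common-neighbour-orbit {x = x} hom w w-injective w-clique x~w =
    let α , α-extends = hom (x Vector.∷ Vector.tail w) w xw-injective w-injective
                            (cliques-same-adjacency xw-clique w-clique)
    in α , α-extends zero
    where
    x≢w : ∀ i → x ≢ w i
    x≢w i refl = irrfl G (x~w i)
    xw-injective : Injective _≡_ _≡_ (x Vector.∷ Vector.tail w)
    xw-injective {zero}  {zero}  _  = refl
    xw-injective {zero}  {suc j} eq = contradiction eq (x≢w (suc j))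
    xw-injective {suc i} {zero}  eq = contradiction (sym eq) (x≢w (suc i))
    xw-injective {suc i} {suc j} eq = cong suc (suc-injective (w-injective eq))
    xw-clique : IsClique (x Vector.∷ Vector.tail w)
    xw-clique zero    zero    0≢0   = contradiction refl 0≢0
    xw-clique zero    (suc j) _     = x~w (suc j)
    xw-clique (suc i) zero    _     = Graph.sym G (x~w (suc i))
    xw-clique (suc i) (suc j) si≢sj = w-clique (suc i) (suc j) si≢sj

module Colouring (G : Graph) {v : ℕ} {xs : List ℕ} (v-orbit⊆xs : ∀ x → SameOrbit G v x → x ∈ xs) where

  Colour : ℕ → ℕ ⊎ ℕ → Set
  Colour w (inj₁ x) = w ≡ x
  Colour w (inj₂ y) = w ∉ xs × E G w y × SameOrbit G v y

  palette : List (ℕ ⊎ ℕ)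
  palette = map inj₁ xs ++ map inj₂ xs

  colour : (∀ w → w ∉ xs → ∃[ y ] E G w y × SameOrbit G v y) →
    ∀ w → ∃[ d ] d ∈ palette × Colour w d
  colour neighbour w with w ∈? xs
  ... | yes w∈xs = inj₁ w , ∈-++⁺ˡ (∈-map⁺ inj₁ w∈xs) , refl
  ... | no w∉xs  =
    let y , w~y , v~y = neighbour w w∉xs
    in inj₂ y , ∈-++⁺ʳ (map inj₁ xs) (∈-map⁺ inj₂ (v-orbit⊆xs y v~y)) , w∉xs , w~y , v~y

  ¬monochromatic-clique : ∀ {t} → Homogeneous (suc t) G →
    (w : Fin (suc (suc t)) → ℕ) → Injective _≡_ _≡_ w → IsClique G w →
    ∀ d → (∀ i → Colour (w i) d) → ⊥
  ¬monochromatic-clique hom w w-injective w-clique (inj₁ x) coloured =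
    contradiction (w-injective (trans (coloured zero) (sym (coloured (suc zero))))) λ ()
  ¬monochromatic-clique hom w w-injective w-clique (inj₂ y) coloured =
    w₁∉xs (v-orbit⊆xs _ (orbit-trans G v~y y~w₁))
    where
    w₁∉xs : w (suc zero) ∉ xs
    w₁∉xs = proj₁ (coloured (suc zero))
    v~y : SameOrbit G v y
    v~y = proj₂ (proj₂ (coloured zero))
    y~w₁ : SameOrbit G y (w (suc zero))
    y~w₁ = common-neighbour-orbit G hom (Vector.tail w) (suc-injective ∘ w-injective)
             (∘-isClique G w-clique suc-injective) (λ i → Graph.sym G (proj₁ (proj₂ (coloured (suc i)))))

lemma3 : (G : Graph) (k : ℕ) → k ≥ 1 → HomogeneousFrom k G → ¬ Homogeneous 1 G →
    ContainsK∞ G → (u v : ℕ) → ExactlyTwoOrbits G u v →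
    OrbitInfinite G u → OrbitFinite G v →
    ∀ a b → SameOrbit G u a → SameOrbit G v b → ¬ E G a b
lemma3 G (suc t) _ hom _ (f , f-injective , f-clique) u v (_ , two) _ (xs , v-orbit⊆xs) a b u~a v~b a~b =
  let d , s , s-injective , s-coloured =
        monochromatic-family (≡-dec _≟_ _≟_) (proj₁ ∘ colouring ∘ f) palette
          (proj₁ ∘ proj₂ ∘ colouring ∘ f) (suc (suc t))
  in ¬monochromatic-clique (hom (suc t) ≤-refl) (f ∘ s)
       (s-injective ∘ f-injective) (∘-isClique G f-clique s-injective) d
       (λ i → subst (Colour (f (s i))) (s-coloured i) (proj₂ (proj₂ (colouring (f (s i))))))
  where
  open Colouring G v-orbit⊆xs

  neighbour : ∀ w → w ∉ xs → ∃[ y ] E G w y × SameOrbit G v y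
  neighbour w w∉xs with two w
  ... | inj₂ v~w = contradiction (v-orbit⊆xs w v~w) w∉xs
  ... | inj₁ u~w =
    let y , b~y , w~y = edge-transport G a~b (orbit-trans G (orbit-sym G u~a) u~w)
    in y , w~y , orbit-trans G v~b b~y

  colouring : ∀ w → ∃[ d ] d ∈ palette × Colour w d
  colouring = colour neighbour
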